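{- Let $\Gamma$ be a triangulation of a connected closed $2$-dimensional (not necessarily orientable) surface. Let $\mathrm{G}_1$ be the subgraph of the dual graph $\Gamma^{*}$ induced on the set of faces $F$ of $\Gamma$ whose $z$-monodromy $M_F$ is the identity, and let $\mathrm{G}_2$ be the subgraph of $\Gamma^{*}$ induced on the set of faces $F$ whose $z$-monodromy satisfies $M_F=D_F$. Then $\mathrm{G}_1$ and $\mathrm{G}_2$ are forests.
   Context: A triangulation of a surface $M$ is a closed $2$-cell embedding of a finite connected graph in $M$ such that every face contains exactly three edges, every edge lies in exactly two distinct faces, and the intersection of two distinct faces is an edge, a vertex, or empty. A zigzag is a sequence of edges $\{e_i\}_{i\in\mathbb N}$ such that for every $i$: $e_i,e_{i+1}$ share a vertex and lie in a common face; the faces containing $e_i,e_{i+1}$ and $e_{i+1},e_{i+2}$ are distinct, and $e_i,e_{i+2}$ are disjoint. It is cyclic and is written $e_1,\dots,e_n$ with minimal period $n$; a zigzag traverses each of its edges in a definite direction (consecutive edges share a vertex), and any two consecutive oriented edges determine the zigzag uniquely. For a face $F$ with vertices $a,b,c$, let $\Omega(F)=\{ab,bc,ca,ac,cb,ba\}$ be its set of oriented edges ($xy$ is the edge from $x$ to $y$) and $D_F$ the permutation $(ab,bc,ca)(ac,cb,ba)$ of $\Omega(F)$. The $z$-monodromy $M_F$ is the permutation of $\Omega(F)$ defined as follows: for $e\in\Omega(F)$ take $e_0\in\Omega(F)$ with $D_F(e_0)=e$, consider the zigzag containing the consecutive oriented edges $e_0,e$, and let $M_F(e)$ be the first element of $\Omega(F)$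 (edge of $F$ with the direction in which the zigzag traverses it) occurring in this zigzag after $e$. The dual graph $\Gamma^*$ has the faces of $\Gamma$ as vertices, two faces being adjacent iff they share an edge. -}

module Defs where

open import Data.Nat using (ℕ; zero; suc; _≤_; _<_)
open import Data.Fin using (Fin; zero; suc; inject₁; fromℕ)
open import Data.Product using (Σ; ∃; ∃-syntax; _×_; _,_)
open import Data.Sum using (_⊎_)
open import Relation.Binary.PropositionalEquality using (_≡_; _≢_)
open import Relation.Binary.Construct.Closure.ReflexiveTransitive using (Star)
open import Relation.Nullary using (¬_)
open import Function.Definitions using (Injective)

-- Combinatorial model of a triangulation with vertex set Fin n and
-- face set Fin m.  Face f has the three vertices  face f 0, face f 1, face f 2.

module _ {n m : ℕ} (face : Fin m → Fin 3 → Fin n) where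

  _∈F_ : Fin n → Fin m → Set
  v ∈F f = ∃[ i ] face f i ≡ v

  DualAdj : Fin m → Fin m → Set
  DualAdj f g = f ≢ g × ∃[ x ] ∃[ y ] (x ≢ y × x ∈F f × y ∈F f × x ∈F g × y ∈F g)

  GraphAdj : Fin n → Fin n → Set
  GraphAdj u v = u ≢ v × ∃[ f ] (u ∈F f × v ∈F f)

  LinkAdj : Fin n → Fin m → Fin m → Set
  LinkAdj v f g = f ≢ g × v ∈F f × v ∈F g × ∃[ y ] (y ≢ v × y ∈F f × y ∈F g)

  ExactlyTwoFaces : Fin n → Fin n → Set
  ExactlyTwoFaces x y =
    ∃[ f ] ∃[ g ] (f ≢ g × x ∈F f × y ∈F f × x ∈F g × y ∈F g
      × (∀ h → x ∈F h → y ∈F h → h ≡ f ⊎ h ≡ g))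

record Triangulation (n m : ℕ) : Set where
  field
    face : Fin m → Fin 3 → Fin n
    face-inj : ∀ f → Injective _≡_ _≡_ (face f)
    faces-distinct : ∀ f g → (∀ v → _∈F_ face v f → _∈F_ face v g)
                           → (∀ v → _∈F_ face v g → _∈F_ face v f) → f ≡ g
    edge-two : ∀ x y → GraphAdj face x y → ExactlyTwoFaces face x y
    -- every vertex lies on some face (2-cell embedding, no isolated vertices)
    vertex-on-face : ∀ v → ∃[ f ] _∈F_ face v f
    -- the link of every vertex is a single cycle (closed surface condition):
    -- the faces around v are connected through edges incident with v
    link-connected : ∀ v f g → _∈F_ face v f → _∈F_ face v g
                     → Star (LinkAdj face v) f g
    connected : ∀ u v → Star (GraphAdj face) u v

module _ {n m : ℕ} (T : Triangulation n m) where
  open Triangulation T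

  OEdge : Set
  OEdge = Fin n × Fin n

  InΩ : Fin m → OEdge → Set
  InΩ F (x , y) = _∈F_ face x F × _∈F_ face y F × x ≢ y

  IsD : Fin m → OEdge → OEdge → Set
  IsD F (x , y) (y' , z) = y' ≡ y × _∈F_ face z F × z ≢ x × z ≢ y

  -- zigzag state: oriented edge e = (a , b) together with the face F
  -- containing e and the preceding edge of the zigzag.
  State : Set
  State = OEdge × Fin m

  edgeOf : State → OEdge
  edgeOf (e , _) = e

  Next : State → State → Set
  Next ((y , z) , F) ((z' , w) , F') =
    z' ≡ z × F' ≢ F × _∈F_ face y F' × _∈F_ face z F' × _∈F_ face w F'
    × w ≢ y × w ≢ z

  -- s is the zigzag through consecutive oriented edges e0 , e with
  -- e0 , e in the common face F (state (e , F) at time 0)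
  ZigzagFrom : (ℕ → State) → State → Set
  ZigzagFrom s st = s 0 ≡ st × (∀ i → Next (s i) (s (suc i)))

  -- M_F(e) = e' : along the zigzag through D_F⁻¹(e), e, the first
  -- oriented edge of F strictly after e is e'
  Monodromy : Fin m → OEdge → OEdge → Set
  Monodromy F e e' =
    ∃[ s ] (ZigzagFrom s (e , F) ×
      ∃[ k ] (1 ≤ k × edgeOf (s k) ≡ e'
        × (∀ j → 1 ≤ j → j < k → ¬ InΩ F (edgeOf (s j)))))

  MonoId : Fin m → Set
  MonoId F = ∀ e → InΩ F e → Monodromy F e e

  MonoD : Fin m → Set
  MonoD F = ∀ e → InΩ F e → ∃[ e' ] (IsD F e e' × Monodromy F e e')

  -- a cycle of length k+3 in the subgraph of Γ* induced on faces satisfying P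
  record DualCycle (P : Fin m → Set) (k : ℕ) : Set where
    field
      c : Fin (suc (suc (suc k))) → Fin m
      c-inj : Injective _≡_ _≡_ c
      c-in : ∀ i → P (c i)
      c-adj : ∀ (i : Fin (suc (suc k))) → DualAdj face (c (inject₁ i)) (c (suc i))
      c-close : DualAdj face (c (fromℕ (suc (suc k)))) (c zero)

  IsForest : (Fin m → Set) → Set
  IsForest P = ∀ k → ¬ DualCycle P k

module Submission where

-- A zigzag is the orbit of a state (oriented edge + the face
-- just left) under a deterministic, injective transition map  step.  For a
-- state σ of a face F, its return time is the first positive time at which
-- the orbit is again in F.  If M_F = id the zigzag through e ∈ Ω(F)
-- re-enters F along D_F(e); if M_F = D_F it re-enters along D_F⁻¹(e).  This
-- gives a measure on states of such faces: the return time (M_F = id), or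
-- the sum of the return times of σ and of D_F⁻¹(σ) (M_F = D_F).  Crossing an
-- edge: if F, G share the edge ab and H ≠ F is another neighbour of G, the
-- state of G on the edge shared with H has strictly smaller (resp. larger)
-- measure.  Going twice around a cycle of such faces, the state on the
-- first edge recurs (there are only two orientations) with a moved measure,
-- a contradiction.

open import Defs
open import Data.Nat using (ℕ; zero; suc; _+_; _≤_; _<_; _>_; s≤s; z≤n)
open import Data.Nat.Properties
  using (≤-refl; ≤-trans; ≤-antisym; <-trans; <-irrefl; <-cmp; ≤∧≢⇒<; m≤n⇒∃[o]m+o≡n;
         m≤n+m; n≤1+n; m≤n⇒m≤1+n; m≢1+n+m; 1+n≢0; +-suc; +-comm; +-identityʳ; +-monoʳ-≤; +-monoˡ-≤; suc-injective)
open import Data.Fin using (Fin; zero; suc; fromℕ; toℕ; _≟_)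
open import Data.Fin.Properties using (all?; any?; toℕ-fromℕ; toℕ-inject₁; toℕ-injective)
open import Data.Fin.Relation.Unary.Top using (view; view-fromℕ; ‵fromℕ; ‵inject₁)
open import Data.Product using (Σ; ∃; ∃-syntax; _×_; _,_; proj₁; proj₂)
open import Data.Sum using (_⊎_; inj₁; inj₂) renaming (map to ⊎-map)
open import Data.Empty using (⊥; ⊥-elim)
open import Function using (_∘_)
open import Relation.Binary.Definitions using (tri<; tri≈; tri>)
open import Relation.Nullary using (¬_; Dec; yes; no)
open import Relation.Nullary.Decidable using (¬?; _×-dec_; _⊎-dec_; _→-dec_; from-yes)
open import Relation.Binary.PropositionalEquality

fin3-exhausted : (i j k l : Fin 3) → i ≢ j → i ≢ k → j ≢ k → l ≡ i ⊎ l ≡ j ⊎ l ≡ k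
fin3-exhausted = from-yes (all? {n = 3} λ i → all? λ j → all? λ k → all? λ l →
  ¬? (i ≟ j) →-dec ¬? (i ≟ k) →-dec ¬? (j ≟ k) →-dec (l ≟ i ⊎-dec l ≟ j ⊎-dec l ≟ k))

fin3-avoid : (i j : Fin 3) → ∃[ k ] (k ≢ i × k ≢ j)
fin3-avoid = from-yes (all? {n = 3} λ i → all? λ j → any? λ k → ¬? (k ≟ i) ×-dec ¬? (k ≟ j))

cyclic-suc : ∀ {N} → Fin (suc N) → Fin (suc N)
cyclic-suc i with view i
... | ‵fromℕ = zero
... | ‵inject₁ j = suc j

cyclic-suc-last : ∀ N → cyclic-suc (fromℕ N) ≡ zero
cyclic-suc-last N rewrite view-fromℕ N = refl

toℕ-cyclic-suc : ∀ {N} (i : Fin (suc N))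
                 → toℕ (cyclic-suc i) ≡ suc (toℕ i) ⊎ (toℕ i ≡ N × cyclic-suc i ≡ zero)
toℕ-cyclic-suc {N} i with view i
... | ‵fromℕ = inj₂ (toℕ-fromℕ N , refl)
... | ‵inject₁ j = inj₁ (cong suc (sym (toℕ-inject₁ j)))

cyclic-suc-twice : ∀ {N} → 2 ≤ N → (i : Fin (suc N)) → cyclic-suc (cyclic-suc i) ≢ i
cyclic-suc-twice (s≤s (s≤s z≤n)) i back with toℕ-cyclic-suc i | toℕ-cyclic-suc (cyclic-suc i)
... | inj₁ once | inj₁ twice =
  m≢1+n+m (toℕ i) {1} (trans (sym (cong toℕ back)) (trans twice (cong suc once)))
... | inj₁ once | inj₂ (last , wraps) =
  1+n≢0 (suc-injective (trans (sym last) (trans once (cong (suc ∘ toℕ) (trans (sym back) wraps)))))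
... | inj₂ (last , wraps) | inj₁ twice =
  1+n≢0 (suc-injective
    (trans (sym last) (trans (cong toℕ (sym back)) (trans twice (cong (suc ∘ toℕ) wraps)))))
... | inj₂ (_ , wraps) | inj₂ (last , _) = 1+n≢0 (trans (sym last) (cong toℕ wraps))

module CycleWalk {n m : ℕ} {T : Triangulation n m} {P : Fin m → Set} {k : ℕ}
                 (C : DualCycle T P k) where
  open DualCycle C
  open Triangulation T using (face)

  length : ℕ
  length = suc (suc (suc k))

  position : ℕ → Fin length
  position zero = zero
  position (suc j) = cyclic-suc (position j)

  walk : ℕ → Fin m
  walk j = c (position j)

  walk-good : ∀ j → P (walk j)
  walk-good j = c-in (position j)

  walk-adjacent : ∀ j → DualAdj face (walk j) (walk (suc j))
  walk-adjacent j = cycle-adjacent (position j)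
    where
    cycle-adjacent : ∀ i → DualAdj face (c i) (c (cyclic-suc i))
    cycle-adjacent i with view i
    ... | ‵fromℕ = c-close
    ... | ‵inject₁ j = c-adj j

  walk-turns : ∀ j → walk (suc (suc j)) ≢ walk j
  walk-turns j = cyclic-suc-twice (s≤s (s≤s z≤n)) (position j) ∘ c-inj

  toℕ-position : ∀ j → j < length → toℕ (position j) ≡ j
  toℕ-position zero _ = refl
  toℕ-position (suc j) (s≤s j<N)
    with toℕ-cyclic-suc (position j) | toℕ-position j (≤-trans j<N (n≤1+n _))
  ... | inj₁ incremented | ih = trans incremented (cong suc ih)
  ... | inj₂ (last , _) | ih = ⊥-elim (<-irrefl (trans (sym ih) last) j<N)

  position-period : ∀ j → position (j + length) ≡ position j
  position-period zero = begin
    cyclic-suc (position (suc (suc k)))       ≡⟨ cong cyclic-suc last ⟩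
    cyclic-suc (fromℕ (suc (suc k)))          ≡⟨ cyclic-suc-last (suc (suc k)) ⟩
    zero                                      ∎
    where
    open ≡-Reasoning
    last : position (suc (suc k)) ≡ fromℕ (suc (suc k))
    last = toℕ-injective (trans (toℕ-position (suc (suc k)) ≤-refl) (sym (toℕ-fromℕ _)))
  position-period (suc j) = cong cyclic-suc (position-period j)

  walk-period : ∀ j → walk (j + length) ≡ walk j
  walk-period j = cong c (position-period j)

module Zigzag {n m : ℕ} (T : Triangulation n m) where
  open Triangulation T

  infix 4 _∈ᶠ_
  _∈ᶠ_ : Fin n → Fin m → Set
  v ∈ᶠ F = _∈F_ face v F

  vertex-among : ∀ F {x y z v} → x ∈ᶠ F → y ∈ᶠ F → z ∈ᶠ F → x ≢ y → x ≢ z → y ≢ z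
                 → v ∈ᶠ F → v ≡ x ⊎ v ≡ y ⊎ v ≡ z
  vertex-among F (i , refl) (j , refl) (k , refl) x≢y x≢z y≢z (l , refl) =
    ⊎-map (cong (face F)) (⊎-map (cong (face F)) (cong (face F)))
      (fin3-exhausted i j k l (x≢y ∘ cong (face F)) (x≢z ∘ cong (face F)) (y≢z ∘ cong (face F)))

  face-by-vertices : ∀ F G {x y z} → x ≢ y → x ≢ z → y ≢ z
                     → x ∈ᶠ F → y ∈ᶠ F → z ∈ᶠ F → x ∈ᶠ G → y ∈ᶠ G → z ∈ᶠ G → F ≡ G
  face-by-vertices F G x≢y x≢z y≢z xF yF zF xG yG zG =
    faces-distinct F G
      (λ v vF → one-of (vertex-among F xF yF zF x≢y x≢z y≢z vF) xG yG zG)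
      (λ v vG → one-of (vertex-among G xG yG zG x≢y x≢z y≢z vG) xF yF zF)
    where
    one-of : ∀ {H v x y z} → v ≡ x ⊎ v ≡ y ⊎ v ≡ z → x ∈ᶠ H → y ∈ᶠ H → z ∈ᶠ H → v ∈ᶠ H
    one-of (inj₁ refl) xH _ _ = xH
    one-of (inj₂ (inj₁ refl)) _ yH _ = yH
    one-of (inj₂ (inj₂ refl)) _ _ zH = zH

  edge-in-two-faces : ∀ {x y} F G H → x ≢ y → x ∈ᶠ F → y ∈ᶠ F → x ∈ᶠ G → y ∈ᶠ G
                      → x ∈ᶠ H → y ∈ᶠ H → F ≢ G → H ≡ F ⊎ H ≡ G
  edge-in-two-faces {x} {y} F G H x≢y xF yF xG yG xH yH F≢G
    with edge-two x y (x≢y , F , xF , yF)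
  ... | (_ , _ , _ , _ , _ , _ , _ , only) with only F xF yF | only G xG yG | only H xH yH
  ... | inj₁ refl | inj₁ refl | _ = ⊥-elim (F≢G refl)
  ... | inj₂ refl | inj₂ refl | _ = ⊥-elim (F≢G refl)
  ... | inj₁ refl | inj₂ refl | inj₁ refl = inj₁ refl
  ... | inj₁ refl | inj₂ refl | inj₂ refl = inj₂ refl
  ... | inj₂ refl | inj₁ refl | inj₁ refl = inj₂ refl
  ... | inj₂ refl | inj₁ refl | inj₂ refl = inj₁ refl

  _∈?_ : (v : Fin n) (F : Fin m) → Dec (v ∈ᶠ F)
  v ∈? F = any? (λ i → face F i ≟ v)

  -- The face across the edge yz from F, and the vertex of F opposite to yz.
  -- They are found by search; only their specifications are used.
  abstract
    across : Fin m → Fin n → Fin n → Fin m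
    across F y z with any? (λ G → ¬? (G ≟ F) ×-dec (y ∈? G ×-dec z ∈? G))
    ... | yes (G , _) = G
    ... | no _ = F

    across-spec : ∀ F {y z} → y ∈ᶠ F → z ∈ᶠ F → y ≢ z
                  → across F y z ≢ F × y ∈ᶠ across F y z × z ∈ᶠ across F y z
    across-spec F {y} {z} yF zF y≢z with any? (λ G → ¬? (G ≟ F) ×-dec (y ∈? G ×-dec z ∈? G))
    ... | yes (_ , found) = found
    ... | no none with edge-two y z (y≢z , F , yF , zF)
    ... | (G₁ , G₂ , G₁≢G₂ , yG₁ , zG₁ , yG₂ , zG₂ , _) with G₁ ≟ F
    ... | yes refl = ⊥-elim (none (G₂ , G₁≢G₂ ∘ sym , yG₂ , zG₂))
    ... | no G₁≢F = ⊥-elim (none (G₁ , G₁≢F , yG₁ , zG₁))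

    third : Fin m → Fin n → Fin n → Fin n
    third F y z with any? (λ i → ¬? (face F i ≟ y) ×-dec ¬? (face F i ≟ z))
    ... | yes (i , _) = face F i
    ... | no _ = y

    third-spec : ∀ F {y z} → y ∈ᶠ F → z ∈ᶠ F → third F y z ∈ᶠ F × third F y z ≢ y × third F y z ≢ z
    third-spec F {y} {z} (iy , iy↦y) (iz , iz↦z)
      with any? (λ i → ¬? (face F i ≟ y) ×-dec ¬? (face F i ≟ z))
    ... | yes (i , i↦̸y , i↦̸z) = (i , refl) , i↦̸y , i↦̸z
    ... | no none with fin3-avoid iy iz
    ... | (k , k≢iy , k≢iz) =
      ⊥-elim (none (k , (λ e → k≢iy (face-inj F (trans e (sym iy↦y))))
                      , (λ e → k≢iz (face-inj F (trans e (sym iz↦z))))))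

  across-unique : ∀ F {y z} G → y ∈ᶠ F → z ∈ᶠ F → y ≢ z → G ≢ F → y ∈ᶠ G → z ∈ᶠ G → G ≡ across F y z
  across-unique F G yF zF y≢z G≢F yG zG with across-spec F yF zF y≢z
  ... | (A≢F , yA , zA) with edge-in-two-faces F (across F _ _) G y≢z yF zF yA zA yG zG (A≢F ∘ sym)
  ... | inj₁ G≡F = ⊥-elim (G≢F G≡F)
  ... | inj₂ G≡A = G≡A

  third-unique : ∀ F {y z} w → y ∈ᶠ F → z ∈ᶠ F → y ≢ z → w ∈ᶠ F → w ≢ y → w ≢ z → w ≡ third F y z
  third-unique F w yF zF y≢z wF w≢y w≢z with third-spec F yF zF
  ... | (tF , t≢y , t≢z) with vertex-among F yF zF tF y≢z (t≢y ∘ sym) (t≢z ∘ sym) wF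
  ... | inj₁ w≡y = ⊥-elim (w≢y w≡y)
  ... | inj₂ (inj₁ w≡z) = ⊥-elim (w≢z w≡z)
  ... | inj₂ (inj₂ w≡t) = w≡t

  St : Set
  St = State T

  face-of : St → Fin m
  face-of = proj₂

  Valid : St → Set
  Valid (e , F) = InΩ T F e

  step : St → St
  step ((y , z) , F) = ((z , third (across F y z) y z) , across F y z)

  step-valid : ∀ {σ} → Valid σ → Valid (step σ)
  step-valid {(y , z) , F} (yF , zF , y≢z) with across-spec F yF zF y≢z
  ... | (_ , yG , zG) with third-spec (across F y z) yG zG
  ... | (wG , _ , w≢z) = zG , wG , w≢z ∘ sym

  Next-is-step : ∀ {σ τ} → Valid σ → Next T σ τ → τ ≡ step σ
  Next-is-step {(y , z) , F} {(_ , w) , G} (yF , zF , y≢z) (refl , G≢F , yG , zG , wG , w≢y , w≢z)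
    with across-unique F G yF zF y≢z G≢F yG zG
  ... | refl with third-unique G w yG zG y≢z wG w≢y w≢z
  ... | refl = refl

  -- step can be undone: go back across the edge from the previous vertex
  unstep : St → St
  unstep ((z , w) , G) = ((third G z w , z) , across G (third G z w) z)

  unstep-step : ∀ {σ} → Valid σ → unstep (step σ) ≡ σ
  unstep-step {(y , z) , F} (yF , zF , y≢z) with across-spec F yF zF y≢z
  ... | (G≢F , yG , zG) with third-spec (across F y z) yG zG
  ... | (wG , w≢y , w≢z)
    with third-unique (across F y z) y zG wG (w≢z ∘ sym) yG y≢z (w≢y ∘ sym)
  ... | y≡t rewrite sym y≡t with across-unique (across F y z) F yG zG y≢z (G≢F ∘ sym) yF zF
  ... | F≡A rewrite sym F≡A = refl

  step-injective : ∀ {σ σ'} → Valid σ → Valid σ' → step σ ≡ step σ' → σ ≡ σ'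
  step-injective {σ} {σ'} v v' e = begin
    σ                ≡⟨ unstep-step v ⟨
    unstep (step σ)  ≡⟨ cong unstep e ⟩
    unstep (step σ') ≡⟨ unstep-step v' ⟩
    σ'               ∎
    where open ≡-Reasoning

  run : ℕ → St → St
  run zero σ = σ
  run (suc t) σ = run t (step σ)

  run-valid : ∀ t {σ} → Valid σ → Valid (run t σ)
  run-valid zero v = v
  run-valid (suc t) v = run-valid t (step-valid v)

  run-suc : ∀ t σ → run (suc t) σ ≡ step (run t σ)
  run-suc zero σ = refl
  run-suc (suc t) σ = run-suc t (step σ)

  run-+ : ∀ s t σ → run (s + t) σ ≡ run t (run s σ)
  run-+ zero t σ = refl
  run-+ (suc s) t σ = run-+ s t (step σ)

  zigzag-is-run : ∀ {s σ} → Valid σ → ZigzagFrom T s σ → ∀ i → s i ≡ run i σ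
  zigzag-is-run v (s₀ , _) zero = s₀
  zigzag-is-run {s} {σ} v z@(_ , next) (suc i) = begin
    s (suc i)        ≡⟨ Next-is-step (subst Valid (sym ih) (run-valid i v)) (next i) ⟩
    step (s i)       ≡⟨ cong step ih ⟩
    step (run i σ)   ≡⟨ run-suc i σ ⟨
    run (suc i) σ    ∎
    where
    open ≡-Reasoning
    ih : s i ≡ run i σ
    ih = zigzag-is-run v z i

  FirstReturn : St → ℕ → Set
  FirstReturn σ R = 1 ≤ R × face-of (run R σ) ≡ face-of σ
                    × (∀ t → 1 ≤ t → face-of (run t σ) ≡ face-of σ → R ≤ t)

  ReturnsAt : St → ℕ → St → Set
  ReturnsAt σ R τ = FirstReturn σ R × run R σ ≡ τ

  first-return-unique : ∀ {σ R R'} → FirstReturn σ R → FirstReturn σ R' → R ≡ R'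
  first-return-unique (1≤R , back , R-first) (1≤R' , back' , R'-first) =
    ≤-antisym (R-first _ 1≤R' back') (R'-first _ 1≤R back)

  -- A zigzag needs at least three steps to return to a face: after one step
  -- it is across an edge, and a face sharing both visited edges with the
  -- start would share three vertices with it.
  first-return-≥3 : ∀ {σ R} → Valid σ → FirstReturn σ R → 3 ≤ R
  first-return-≥3 {(y , z) , F} (yF , zF , y≢z) (1≤R , back , _)
    with across-spec F yF zF y≢z
  ... | (G≢F , yG , zG) with third-spec (across F y z) yG zG
  ... | (wG , w≢y , w≢z) = at-least-3 _ 1≤R back
    where
    G : Fin m
    G = across F y z
    w : Fin n
    w = third G y z
    leaves-twice : across G z w ≢ F
    leaves-twice H≡F with across-spec G zG wG (w≢z ∘ sym)
    ... | (_ , _ , wH) =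
      G≢F (sym (face-by-vertices F G y≢z (w≢y ∘ sym) (w≢z ∘ sym) yF zF (subst (w ∈ᶠ_) H≡F wH) yG zG wG))
    at-least-3 : ∀ R → 1 ≤ R → face-of (run R ((y , z) , F)) ≡ F → 3 ≤ R
    at-least-3 (suc zero) _ back = ⊥-elim (G≢F back)
    at-least-3 (suc (suc zero)) _ back = ⊥-elim (leaves-twice back)
    at-least-3 (suc (suc (suc R))) _ _ = s≤s (s≤s (s≤s z≤n))

  returns-before : ∀ {σ R₁ τ₁ R₂ A τ} → ReturnsAt σ R₁ τ₁ → FirstReturn τ₁ R₂ → 1 ≤ A
                   → run A σ ≡ τ → face-of τ ≡ face-of σ → τ ≢ τ₁ → R₁ + R₂ ≤ A
  returns-before {σ} {R₁} {τ₁} {R₂} {A} {τ} ((_ , τ₁∈F , R₁-first) , arrives) (_ , _ , R₂-first)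
                 1≤A reaches τ∈F τ≢τ₁
    with m≤n⇒∃[o]m+o≡n (≤∧≢⇒< (R₁-first A 1≤A (trans (cong face-of reaches) τ∈F)) R₁≢A)
    where
    R₁≢A : R₁ ≢ A
    R₁≢A R₁≡A = τ≢τ₁ (trans (sym reaches) (trans (cong (λ t → run t σ) (sym R₁≡A)) arrives))
  ... | r , R₁+1+r≡A =
    subst (R₁ + R₂ ≤_) A≡R₁+[1+r] (+-monoʳ-≤ R₁ (R₂-first (suc r) (s≤s z≤n) τ₁-to-τ-in-F))
    where
    A≡R₁+[1+r] : R₁ + suc r ≡ A
    A≡R₁+[1+r] = trans (+-suc R₁ r) R₁+1+r≡A
    τ₁-to-τ-in-F : face-of (run (suc r) τ₁) ≡ face-of τ₁
    τ₁-to-τ-in-F = begin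
      face-of (run (suc r) τ₁)          ≡⟨ cong (face-of ∘ run (suc r)) arrives ⟨
      face-of (run (suc r) (run R₁ σ))  ≡⟨ cong face-of (run-+ R₁ (suc r) σ) ⟨
      face-of (run (R₁ + suc r) σ)      ≡⟨ cong (λ t → face-of (run t σ)) A≡R₁+[1+r] ⟩
      face-of (run A σ)                 ≡⟨ cong face-of reaches ⟩
      face-of τ                         ≡⟨ τ∈F ⟩
      face-of σ                         ≡⟨ τ₁∈F ⟨
      face-of (run R₁ σ)                ≡⟨ cong face-of arrives ⟩
      face-of τ₁                        ∎
      where open ≡-Reasoning

  -- the state in which a zigzag enters F right after traversing pq ∈ Ω(F)
  enter : Fin m → OEdge T → St
  enter F (p , q) = ((q , third F p q) , F)

  -- D_F and D_F⁻¹ acting on states of F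
  forward : St → St
  forward (e , F) = enter F e

  backward : St → St
  backward ((a , b) , F) = ((third F a b , a) , F)

  backward-valid : ∀ {σ} → Valid σ → Valid (backward σ)
  backward-valid {(a , b) , F} (aF , bF , _) with third-spec F aF bF
  ... | (cF , c≢a , _) = cF , aF , c≢a

  step-into : ∀ {ρ F} → Valid ρ → InΩ T F (proj₁ ρ) → face-of ρ ≢ F → step ρ ≡ enter F (proj₁ ρ)
  step-into {(p , q) , H} {F} (pH , qH , p≢q) (pF , qF , _) H≢F
    with across-unique H F pH qH p≢q (H≢F ∘ sym) pF qF
  ... | refl = refl

  step-into-converse : ∀ {ρ F} → Valid ρ → face-of (step ρ) ≡ F → InΩ T F (proj₁ ρ) × face-of ρ ≢ F
  step-into-converse {(p , q) , H} (pH , qH , p≢q) refl with across-spec H pH qH p≢q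
  ... | (G≢H , pG , qG) = (pG , qG , p≢q) , G≢H ∘ sym

  -- The monodromy M_F(ab) = e' says: the zigzag through ab returns to F
  -- for the first time right after traversing e'.
  monodromy-return : ∀ {F a b e'} → Valid ((a , b) , F) → InΩ T F e' → Monodromy T F (a , b) e'
                     → ∃[ R ] ReturnsAt ((a , b) , F) R (enter F e')
  monodromy-return {F} {a} {b} {e'} v e'∈Ω (s , zigzag , k , 1≤k , s-k , between) =
    suc k , (s≤s z≤n , cong face-of arrival , minimal) , arrival
    where
    σ : St
    σ = ((a , b) , F)
    on-run : ∀ j → s j ≡ run j σ
    on-run = zigzag-is-run v zigzag
    at-k : proj₁ (run k σ) ≡ e'
    at-k = trans (cong proj₁ (sym (on-run k))) s-k
    not-in-Ω : ∀ j → 1 ≤ j → j < k → ¬ InΩ T F (proj₁ (run j σ))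
    not-in-Ω j 1≤j j<k = between j 1≤j j<k ∘ subst (InΩ T F ∘ proj₁) (sym (on-run j))
    outside : ∀ j → 1 ≤ j → j ≤ k → face-of (run j σ) ≢ F
    outside (suc j) _ j<k in-F
      with step-into-converse (run-valid j v) (trans (cong face-of (sym (run-suc j σ))) in-F)
    outside (suc zero) _ _ _ | _ , F≢F = F≢F refl
    outside (suc (suc j)) _ j<k _ | e∈Ω , _ = not-in-Ω (suc j) (s≤s z≤n) j<k e∈Ω
    arrival : run (suc k) σ ≡ enter F e'
    arrival = begin
      run (suc k) σ               ≡⟨ run-suc k σ ⟩
      step (run k σ)              ≡⟨ step-into (run-valid k v) (subst (InΩ T F) (sym at-k) e'∈Ω)
                                               (outside k 1≤k ≤-refl) ⟩
      enter F (proj₁ (run k σ))   ≡⟨ cong (enter F) at-k ⟩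
      enter F e'                  ∎
      where open ≡-Reasoning
    minimal : ∀ t → 1 ≤ t → face-of (run t σ) ≡ F → suc k ≤ t
    minimal t 1≤t in-F with <-cmp t k
    ... | tri< t<k _ _ =
      ⊥-elim (not-in-Ω t 1≤t t<k (subst (λ G → InΩ T G (proj₁ (run t σ))) in-F (run-valid t v)))
    ... | tri≈ _ refl _ = ⊥-elim (outside t 1≤t ≤-refl in-F)
    ... | tri> _ _ k<t = k<t

  returns-id : ∀ {F} → MonoId T F → ∀ {σ} → face-of σ ≡ F → Valid σ → ∃[ R ] ReturnsAt σ R (forward σ)
  returns-id M {(a , b) , _} refl v = monodromy-return v v (M (a , b) v)

  returns-D : ∀ {F} → MonoD T F → ∀ {σ} → face-of σ ≡ F → Valid σ → ∃[ R ] ReturnsAt σ R (backward σ)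
  returns-D {F} M {(a , b) , _} refl v@(aF , bF , a≢b) with M (a , b) v
  ... | (_ , c) , (refl , cF , c≢a , c≢b) , mono with monodromy-return v (bF , cF , c≢b ∘ sym) mono
  ... | R , returns = R , subst (ReturnsAt ((a , b) , F) R) enter-is-backward returns
    where
    enter-is-backward : enter F (b , c) ≡ backward ((a , b) , F)
    enter-is-backward =
      cong₂ (λ u w → ((u , w) , F))
        (third-unique F c aF bF a≢b cF c≢a c≢b)
        (sym (third-unique F a bF cF (c≢b ∘ sym) aF (a≢b) (c≢a ∘ sym)))

  IdMeasure : St → ℕ → Set
  IdMeasure σ ℓ = ReturnsAt σ ℓ (forward σ)

  DMeasure : St → ℕ → Set
  DMeasure σ ℓ = ∃[ R₁ ] ∃[ R₂ ] (ReturnsAt σ R₁ (backward σ) × FirstReturn (backward σ) R₂ × ℓ ≡ R₁ + R₂)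

  IdMeasure-functional : ∀ σ {ℓ ℓ'} → IdMeasure σ ℓ → IdMeasure σ ℓ' → ℓ ≡ ℓ'
  IdMeasure-functional _ (R , _) (R' , _) = first-return-unique R R'

  DMeasure-functional : ∀ σ {ℓ ℓ'} → DMeasure σ ℓ → DMeasure σ ℓ' → ℓ ≡ ℓ'
  DMeasure-functional _ (_ , _ , (R₁ , _) , R₂ , refl) (_ , _ , (R₁' , _) , R₂' , refl) =
    cong₂ _+_ (first-return-unique R₁ R₁') (first-return-unique R₂ R₂')

  DMeasure-exists : ∀ {F} → MonoD T F → ∀ {σ} → face-of σ ≡ F → Valid σ → ∃ (DMeasure σ)
  DMeasure-exists M σ∈F v with returns-D M σ∈F v | returns-D M σ∈F (backward-valid v)
  ... | R₁ , returns₁ | R₂ , returns₂ = R₁ + R₂ , R₁ , R₂ , returns₁ , proj₁ returns₂ , refl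

  OnSharedEdge : Fin m → Fin m → St → Set
  OnSharedEdge F G ((a , b) , F') = F' ≡ F × a ≢ b × a ∈ᶠ F × b ∈ᶠ F × a ∈ᶠ G × b ∈ᶠ G × F ≢ G

  reverse : St → St
  reverse ((a , b) , F) = ((b , a) , F)

  two-orientations : ∀ {F G σ σ'} → OnSharedEdge F G σ → OnSharedEdge F G σ' → σ' ≡ σ ⊎ σ' ≡ reverse σ
  two-orientations {F} {G} {(a , b) , _} {(a' , b') , _}
    (refl , a≢b , aF , bF , aG , bG , F≢G) (refl , a'≢b' , a'F , b'F , a'G , b'G , _)
    with on-edge a'F a'G | on-edge b'F b'G
    where
    on-edge : ∀ {x} → x ∈ᶠ F → x ∈ᶠ G → x ≡ a ⊎ x ≡ b
    on-edge {x} xF xG with x ≟ a | x ≟ b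
    ... | yes x≡a | _ = inj₁ x≡a
    ... | no _ | yes x≡b = inj₂ x≡b
    ... | no x≢a | no x≢b =
      ⊥-elim (F≢G (face-by-vertices F G a≢b (x≢a ∘ sym) (x≢b ∘ sym) aF bF xF aG bG xG))
  ... | inj₁ refl | inj₁ refl = ⊥-elim (a'≢b' refl)
  ... | inj₁ refl | inj₂ refl = inj₁ refl
  ... | inj₂ refl | inj₁ refl = inj₂ refl
  ... | inj₂ refl | inj₂ refl = ⊥-elim (a'≢b' refl)

  three-on-an-edge : ∀ {F G σ₀ σ₁ σ₂} → OnSharedEdge F G σ₀ → OnSharedEdge F G σ₁ → OnSharedEdge F G σ₂
                     → σ₁ ≡ σ₀ ⊎ σ₂ ≡ σ₁ ⊎ σ₂ ≡ σ₀
  three-on-an-edge {σ₀ = (_ , _) , _} on₀ on₁ on₂ with two-orientations on₀ on₁ | two-orientations on₁ on₂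
  ... | inj₁ σ₁≡σ₀ | _ = inj₁ σ₁≡σ₀
  ... | inj₂ _ | inj₁ σ₂≡σ₁ = inj₂ (inj₁ σ₂≡σ₁)
  ... | inj₂ refl | inj₂ refl = inj₂ (inj₂ refl)

  module Crossing {F G a b} (a≢b : a ≢ b) (aF : a ∈ᶠ F) (bF : b ∈ᶠ F) (aG : a ∈ᶠ G) (bG : b ∈ᶠ G)
                  (F≢G : F ≢ G) where
    c d : Fin n
    c = third F a b
    d = third G a b

    c≢b : c ≢ b
    c≢b = proj₂ (proj₂ (third-spec F aF bF))
    dG : d ∈ᶠ G
    dG = proj₁ (third-spec G aG bG)
    d≢a : d ≢ a
    d≢a = proj₁ (proj₂ (third-spec G aG bG))
    d≢b : d ≢ b
    d≢b = proj₂ (proj₂ (third-spec G aG bG))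

    α β σbd σda : St
    α = ((a , b) , F)
    β = ((a , b) , G)
    σbd = ((b , d) , G)
    σda = ((d , a) , G)

    α-valid : Valid α
    α-valid = aF , bF , a≢b
    β-valid : Valid β
    β-valid = aG , bG , a≢b
    σbd-valid : Valid σbd
    σbd-valid = bG , dG , d≢b ∘ sym
    σda-valid : Valid σda
    σda-valid = dG , aG , d≢a

    step-α : step α ≡ σbd
    step-α = step-into α-valid β-valid F≢G

    step-β : step β ≡ forward α
    step-β = step-into β-valid α-valid (F≢G ∘ sym)

    opposite-bd : a ≡ third G b d
    opposite-bd = third-unique G a bG dG (d≢b ∘ sym) aG (a≢b) (d≢a ∘ sym)

    opposite-da : b ≡ third G d a
    opposite-da = third-unique G b dG aG d≢a bG (d≢b ∘ sym) (a≢b ∘ sym)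

    forward-bd : forward σbd ≡ σda
    forward-bd = cong (λ u → ((d , u) , G)) (sym opposite-bd)

    backward-bd : backward σbd ≡ β
    backward-bd = cong (λ u → ((u , b) , G)) (sym opposite-bd)

    backward-da : backward σda ≡ σbd
    backward-da = cong (λ u → ((u , d) , G)) (sym opposite-da)

    ab-only-in-F-G : ∀ {H} → H ≢ F → G ≢ H → a ∈ᶠ H → b ∈ᶠ H → ⊥
    ab-only-in-F-G {H} H≢F G≢H aH bH with edge-in-two-faces F G H a≢b aF bF aG bG aH bH F≢G
    ... | inj₁ H≡F = H≢F H≡F
    ... | inj₂ H≡G = G≢H (sym H≡G)

    next-edge : ∀ {H} → DualAdj face G H → H ≢ F → (b ∈ᶠ H × d ∈ᶠ H) ⊎ (d ∈ᶠ H × a ∈ᶠ H)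
    next-edge {H} (G≢H , x , y , x≢y , xG , yG , xH , yH) H≢F
      with vertex-among G aG bG dG a≢b (d≢a ∘ sym) (d≢b ∘ sym) xG
         | vertex-among G aG bG dG a≢b (d≢a ∘ sym) (d≢b ∘ sym) yG
    ... | inj₁ refl | inj₁ refl = ⊥-elim (x≢y refl)
    ... | inj₂ (inj₁ refl) | inj₂ (inj₁ refl) = ⊥-elim (x≢y refl)
    ... | inj₂ (inj₂ refl) | inj₂ (inj₂ refl) = ⊥-elim (x≢y refl)
    ... | inj₁ refl | inj₂ (inj₁ refl) = ⊥-elim (ab-only-in-F-G H≢F G≢H xH yH)
    ... | inj₂ (inj₁ refl) | inj₁ refl = ⊥-elim (ab-only-in-F-G H≢F G≢H yH xH)
    ... | inj₁ refl | inj₂ (inj₂ refl) = inj₂ (yH , xH)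
    ... | inj₂ (inj₂ refl) | inj₁ refl = inj₂ (xH , yH)
    ... | inj₂ (inj₁ refl) | inj₂ (inj₂ refl) = inj₁ (xH , yH)
    ... | inj₂ (inj₂ refl) | inj₂ (inj₁ refl) = inj₁ (yH , xH)

    -- When the zigzag from α re-enters F along D_F(ab) = bc, it has just
    -- traversed ab from G, having gone around G from σbd to β.
    through-β : ∀ A → run A α ≡ forward α → ∃[ A' ] (A ≡ suc (suc A') × 1 ≤ A' × run A' σbd ≡ β)
    through-β zero α≡fα = ⊥-elim (a≢b (cong (proj₁ ∘ proj₁) α≡fα))
    through-β (suc A) reaches with step-injective (run-valid A α-valid) β-valid
                                     (trans (sym (run-suc A α)) (trans reaches (sym step-β)))
    ... | at-β with A
    ... | zero = ⊥-elim (F≢G (cong face-of at-β))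
    ... | suc zero = ⊥-elim (a≢b (sym (cong (proj₁ ∘ proj₁) (trans (sym step-α) at-β))))
    ... | suc (suc A') = suc A' , refl , s≤s z≤n , trans (cong (run (suc A')) (sym step-α)) at-β

    on-bd : ∀ {H} → DualAdj face G H → b ∈ᶠ H → d ∈ᶠ H → OnSharedEdge G H σbd
    on-bd adj bH dH = refl , d≢b ∘ sym , bG , dG , bH , dH , proj₁ adj

    on-da : ∀ {H} → DualAdj face G H → d ∈ᶠ H → a ∈ᶠ H → OnSharedEdge G H σda
    on-da adj dH aH = refl , d≢a , dG , aG , dH , aH , proj₁ adj

    cross-id : MonoId T G → ∀ {H ℓ} → DualAdj face G H → H ≢ F → IdMeasure α ℓ
               → ∃[ σ' ] ∃[ ℓ' ] (OnSharedEdge G H σ' × IdMeasure σ' ℓ' × ℓ' < ℓ)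
    cross-id M {ℓ = ℓ} adj H≢F (_ , reaches) with through-β ℓ reaches
    ... | A , refl , 1≤A , bd-to-β with next-edge adj H≢F
    ... | inj₁ (bH , dH) with returns-id M {σbd} refl σbd-valid
    ...   | R , returns = σbd , R , on-bd adj bH dH , returns , s≤s (m≤n⇒m≤1+n R≤A)
      where
      -- going around G from σbd, the zigzag is back in G at β
      R≤A : R ≤ A
      R≤A = proj₂ (proj₂ (proj₁ returns)) A 1≤A (cong face-of bd-to-β)
    cross-id M adj H≢F _ | A , refl , 1≤A , bd-to-β | inj₂ (dH , aH)
      with returns-id M {σbd} refl σbd-valid | returns-id M {σda} refl σda-valid
    ... | B , bd-to-da | R , returns =
      σda , R , on-da adj dH aH , returns , s≤s (m≤n⇒m≤1+n (≤-trans (m≤n+m R B) B+R≤A))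
      where
      β≢σda : β ≢ σda
      β≢σda β≡σda = d≢a (sym (cong (proj₁ ∘ proj₁) β≡σda))
      -- going around G from σbd, the zigzag passes σda before reaching β
      B+R≤A : B + R ≤ A
      B+R≤A = returns-before (subst (ReturnsAt σbd B) forward-bd bd-to-da) (proj₁ returns)
                             1≤A bd-to-β refl β≢σda

    exceeds : ∀ {x B R} → x ≤ suc (suc B) → 3 ≤ R → x < R + B
    exceeds {B = B} x≤2+B 3≤R = ≤-trans (s≤s x≤2+B) (+-monoˡ-≤ B 3≤R)

    -- If the zigzag from σbd first returns to G at β, then the zigzag from α
    -- goes around G and re-enters F along D_F(ab) at time 2 + B; this bounds
    -- the D-measure of α.
    D-measure-bound : ∀ {ℓ B} → DMeasure α ℓ → ReturnsAt σbd B (backward σbd) → ℓ ≤ suc (suc B)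
    D-measure-bound {B = B} (R₁ , R₂ , returns₁ , returns₂ , refl) (_ , bd-to-β) =
      returns-before returns₁ returns₂ (s≤s z≤n) around-G refl forward≢backward
      where
      open ≡-Reasoning
      around-G : run (suc (suc B)) α ≡ forward α
      around-G = begin
        run (suc B) (step α)   ≡⟨ cong (run (suc B)) step-α ⟩
        run (suc B) σbd        ≡⟨ run-suc B σbd ⟩
        step (run B σbd)       ≡⟨ cong step (trans bd-to-β backward-bd) ⟩
        step β                 ≡⟨ step-β ⟩
        forward α              ∎
      forward≢backward : forward α ≢ backward α
      forward≢backward e = c≢b (sym (cong (proj₁ ∘ proj₁) e))

    -- Both
    -- possible new states σbd and σda have a measure made of B (the return
    -- time of σbd, resp. of backward σda = σbd) and a return time ≥ 3.
    cross-D : MonoD T G → ∀ {H ℓ} → DualAdj face G H → H ≢ F → DMeasure α ℓ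
              → ∃[ σ' ] ∃[ ℓ' ] (OnSharedEdge G H σ' × DMeasure σ' ℓ' × ℓ < ℓ')
    cross-D M {ℓ = ℓ} adj H≢F measured with returns-D M {σbd} refl σbd-valid
    ... | B , bd-returns with next-edge adj H≢F
    ... | inj₁ (bH , dH) with returns-D M {backward σbd} refl (backward-valid σbd-valid)
    ...   | R , returns =
      σbd , B + R , on-bd adj bH dH , (B , R , bd-returns , proj₁ returns , refl) ,
      subst (ℓ <_) (+-comm R B)
        (exceeds (D-measure-bound measured bd-returns)
                 (first-return-≥3 (backward-valid σbd-valid) (proj₁ returns)))
    cross-D M adj H≢F measured | B , bd-returns | inj₂ (dH , aH) with returns-D M {σda} refl σda-valid
    ... | R , returns =
      σda , R + B , on-da adj dH aH ,
      (R , B , returns , subst (λ τ → FirstReturn τ B) (sym backward-da) (proj₁ bd-returns) , refl) ,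
      exceeds (D-measure-bound measured bd-returns) (first-return-≥3 σda-valid (proj₁ returns))

  crossing-id : ∀ {F G H σ ℓ} → MonoId T G → OnSharedEdge F G σ → DualAdj face G H → H ≢ F
                → IdMeasure σ ℓ → ∃[ σ' ] ∃[ ℓ' ] (OnSharedEdge G H σ' × IdMeasure σ' ℓ' × ℓ' < ℓ)
  crossing-id M (refl , a≢b , aF , bF , aG , bG , F≢G) = Crossing.cross-id a≢b aF bF aG bG F≢G M

  crossing-D : ∀ {F G H σ ℓ} → MonoD T G → OnSharedEdge F G σ → DualAdj face G H → H ≢ F
               → DMeasure σ ℓ → ∃[ σ' ] ∃[ ℓ' ] (OnSharedEdge G H σ' × DMeasure σ' ℓ' × ℓ' > ℓ)
  crossing-D M (refl , a≢b , aF , bF , aG , bG , F≢G) = Crossing.cross-D a≢b aF bF aG bG F≢G M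

  -- A class of faces spans no cycle of Γ* if every state of a face in the
  -- class has a measure determined by the state, and crossing from one face
  -- of the class to the next strictly moves this measure in a fixed
  -- well-behaved order.
  module NoMeasuredCycle
    (Good : Fin m → Set) (Measure : St → ℕ → Set)
    (_≺_ : ℕ → ℕ → Set) (≺-trans : ∀ {x y z} → x ≺ y → y ≺ z → x ≺ z) (≺-irrefl : ∀ {x} → ¬ x ≺ x)
    (measure-functional : ∀ σ {ℓ ℓ'} → Measure σ ℓ → Measure σ ℓ' → ℓ ≡ ℓ')
    (measure-exists : ∀ {F} → Good F → ∀ {σ} → face-of σ ≡ F → Valid σ → ∃ (Measure σ))
    (cross : ∀ {F G H σ ℓ} → Good G → OnSharedEdge F G σ → DualAdj face G H → H ≢ F → Measure σ ℓ
             → ∃[ σ' ] ∃[ ℓ' ] (OnSharedEdge G H σ' × Measure σ' ℓ' × ℓ' ≺ ℓ))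
    where

    module AroundCycle {k : ℕ} (C : DualCycle T Good k) where
      open CycleWalk C

      record Marked (j : ℕ) : Set where
        field
          state : St
          value : ℕ
          on-edge : OnSharedEdge (walk j) (walk (suc j)) state
          measured : Measure state value
      open Marked

      initial : Marked 0
      initial with walk-adjacent 0
      ... | F≢G , x , y , x≢y , xF , yF , xG , yG
        with measure-exists (walk-good 0) {(x , y) , walk 0} refl (xF , yF , x≢y)
      ... | ℓ , measured = record { state = (x , y) , walk 0 ; value = ℓ
                                  ; on-edge = refl , x≢y , xF , yF , xG , yG , F≢G ; measured = measured }

      advance : ∀ {j} (μ : Marked j) → Σ (Marked (suc j)) λ μ' → value μ' ≺ value μ
      advance {j} μ
        with cross (walk-good (suc j)) (on-edge μ) (walk-adjacent (suc j)) (walk-turns j) (measured μ)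
      ... | σ' , ℓ' , on , measured' , moved =
        record { state = σ' ; value = ℓ' ; on-edge = on ; measured = measured' } , moved

      advance-many : ∀ t {j} (μ : Marked j) → Σ (Marked (suc t + j)) λ μ' → value μ' ≺ value μ
      advance-many zero μ = advance μ
      advance-many (suc t) μ with advance-many t μ
      ... | μ' , μ'≺μ with advance μ'
      ... | μ'' , μ''≺μ' = μ'' , ≺-trans μ''≺μ' μ'≺μ

      round : (μ : Marked 0) → Σ (Marked 0) λ μ' → value μ' ≺ value μ
      round μ with advance-many (suc (suc k)) μ
      ... | μ' , μ'≺μ =
        record { state = state μ' ; value = value μ' ; measured = measured μ'
               ; on-edge = subst₂ (λ F G → OnSharedEdge F G (state μ')) back₀ back₁ (on-edge μ') } , μ'≺μ
        where
        back₀ : walk (length + 0) ≡ walk 0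
        back₀ = trans (cong walk (+-identityʳ length)) (walk-period 0)
        back₁ : walk (suc (length + 0)) ≡ walk 1
        back₁ = trans (cong (walk ∘ suc) (+-identityʳ length)) (walk-period 1)

      -- the measure is a function of the state, so a state cannot recur with a moved measure
      no-recurrence : (μ μ' : Marked 0) → value μ' ≺ value μ → state μ' ≢ state μ
      no-recurrence μ μ' moved same =
        ≺-irrefl (subst (_≺ value μ)
          (measure-functional (state μ) (subst (λ σ → Measure σ (value μ')) same (measured μ')) (measured μ))
          moved)

      -- after two rounds, two of the three states on the first edge coincide
      impossible : ⊥
      impossible with round initial
      ... | μ₁ , μ₁≺μ₀ with round μ₁
      ... | μ₂ , μ₂≺μ₁ with three-on-an-edge (on-edge initial) (on-edge μ₁) (on-edge μ₂)
      ... | inj₁ same = no-recurrence initial μ₁ μ₁≺μ₀ same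
      ... | inj₂ (inj₁ same) = no-recurrence μ₁ μ₂ μ₂≺μ₁ same
      ... | inj₂ (inj₂ same) = no-recurrence initial μ₂ (≺-trans μ₂≺μ₁ μ₁≺μ₀) same

    no-cycle : IsForest T Good
    no-cycle k C = AroundCycle.impossible C

  forest-id : IsForest T (MonoId T)
  forest-id = NoMeasuredCycle.no-cycle (MonoId T) IdMeasure _<_ <-trans (<-irrefl refl)
                IdMeasure-functional returns-id crossing-id

  forest-D : IsForest T (MonoD T)
  forest-D = NoMeasuredCycle.no-cycle (MonoD T) DMeasure _>_ (λ x>y y>z → <-trans y>z x>y) (<-irrefl refl)
               DMeasure-functional DMeasure-exists crossing-D

theorem1 : ∀ (n m : ℕ) (T : Triangulation n m)
    → IsForest T (MonoId T) × IsForest T (MonoD T)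
theorem1 n m T = Zigzag.forest-id T , Zigzag.forest-D T
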